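{- Let $k\ge2$ and $G=\{0,1,\dots,k-1\}$. There is no balanced pairwise independent distribution on $G^k$ such that every $(x_1,\dots,x_k)$ in its support has at least one coordinate equal to $0$.
   Context: A distribution $\mu$ on $G^k$ is balanced pairwise independent if for $x\sim\mu$, $\Pr[x_i=g]=1/|G|$ for all $i$ and $g\in G$, and $\Pr[x_i=g,x_j=g']=1/|G|^2$ for all $i\neq j$ and $g,g'\in G$.
   Formalization: The balanced pairwise independent distributions on $G^k$ whose existence is denied take rational values. -}

module Defs where

open import Data.Nat using (ℕ; zero; suc)
open import Data.Fin using (Fin)
open import Data.Fin.Properties using (_≟_)
open import Data.Vec using (Vec; []; _∷_; lookup)
open import Data.List using (List; []; _∷_; allFin; cartesianProductWith; foldr; map)
open import Data.Rational using (ℚ; 0ℚ; 1ℚ; _+_; _/_; _≤_)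
open import Data.Integer using (+_)
open import Data.Bool using (if_then_else_)
open import Data.Product using (_×_; ∃-syntax)
open import Relation.Nullary using (¬_)
open import Relation.Nullary.Decidable using (⌊_⌋)
open import Data.Bool using (_∧_)
open import Relation.Binary.PropositionalEquality using (_≡_; _≢_)

allVecs : (m n : ℕ) → List (Vec (Fin m) n)
allVecs m zero    = [] ∷ []
allVecs m (suc n) = cartesianProductWith _∷_ (allFin m) (allVecs m n)

sumℚ : List ℚ → ℚ
sumℚ = foldr _+_ 0ℚ

Point : ℕ → Set
Point k = Vec (Fin k) k

total : (k : ℕ) → (Point k → ℚ) → ℚ
total k μ = sumℚ (map μ (allVecs k k))

prob1 : (k : ℕ) → (Point k → ℚ) → Fin k → Fin k → ℚ
prob1 k μ i g = sumℚ (map (λ x → if ⌊ lookup x i ≟ g ⌋ then μ x else 0ℚ) (allVecs k k))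

prob2 : (k : ℕ) → (Point k → ℚ) → Fin k → Fin k → Fin k → Fin k → ℚ
prob2 k μ i j g g' =
  sumℚ (map (λ x → if ⌊ lookup x i ≟ g ⌋ ∧ ⌊ lookup x j ≟ g' ⌋ then μ x else 0ℚ) (allVecs k k))

-- 1/n as a rational (only used with n ≥ 2; value at 0 is irrelevant).
inv : ℕ → ℚ
inv zero    = 0ℚ
inv (suc m) = (+ 1) / suc m

IsDistribution : (k : ℕ) → (Point k → ℚ) → Set
IsDistribution k μ = (∀ x → 0ℚ ≤ μ x) × total k μ ≡ 1ℚ

IsBalancedPairwiseIndependent : (k : ℕ) → (Point k → ℚ) → Set
IsBalancedPairwiseIndependent k μ =
  IsDistribution k μ
  × (∀ (i g : Fin k) → prob1 k μ i g ≡ inv k)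
  × (∀ (i j g g' : Fin k) → i ≢ j → prob2 k μ i j g g' ≡ inv (k Data.Nat.* k))

InSupport : (k : ℕ) → (Point k → ℚ) → Point k → Set
InSupport k μ x = ¬ (μ x ≡ 0ℚ)

{-# OPTIONS --safe #-}
-- The expected number of zero coordinates, Σᵢ Pr[xᵢ = 0], equals k · (1/k) = 1 for a
-- balanced distribution. If every support point has a zero coordinate, this count is
-- at least 1 on the support and at least 2 on the event x₁ = x₂ = 0, which has
-- probability 1/k² by pairwise independence; so the expectation is at least 1 + 1/k².
module Submission where

open import Defs
open import Algebra.Bundles using (CommutativeMonoid)
open import Data.Bool using (Bool; true; false; if_then_else_; _∧_)
open import Data.Fin using (Fin; toℕ; zero; suc)
open import Data.Fin.Properties using (_≟_; suc-injective; toℕ-injective)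
open import Data.List using (List; []; _∷_; map; allFin; tabulate)
open import Data.List.Membership.Propositional using (_∈_)
open import Data.List.Membership.Propositional.Properties using (∈-allFin)
open import Data.List.Properties using (map-cong; map-tabulate)
open import Data.List.Relation.Unary.Any using (here; there)
open import Data.Nat using (ℕ; _≤_; s≤s; z≤n)
import Data.Nat as ℕ
open import Data.Product using (_×_; ∃-syntax; _,_)
open import Data.Rational using (ℚ; 0ℚ; 1ℚ; _+_)
import Data.Rational as ℚ
open import Data.Rational.Properties
  using ( +-identityˡ; +-identityʳ; +-0-commutativeMonoid; +-mono-≤; +-monoʳ-≤; +-monoʳ-<
        ; ≤-refl; ≤-reflexive; ≤-trans; <-irrefl; positive⁻¹; normalize-pos
        ; module ≤-Reasoning)
open import Algebra.Properties.CommutativeSemigroup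
  (CommutativeMonoid.commutativeSemigroup +-0-commutativeMonoid) using (interchange)
open import Data.Vec using (lookup)
open import Relation.Nullary using (¬_; Dec; yes; no; contradiction)
open import Relation.Nullary.Decidable using (⌊_⌋; ⌊⌋-map′)
open import Relation.Binary.PropositionalEquality
  using (_≡_; _≢_; refl; sym; trans; cong; cong₂; module ≡-Reasoning)
open import Function using (id; _∘_)

private
  variable
    A B : Set

infix 7 [_]·_
[_]·_ : Bool → ℚ → ℚ
[ b ]· c = if b then c else 0ℚ

[]·-nonNeg : ∀ b {c} → 0ℚ ℚ.≤ c → 0ℚ ℚ.≤ [ b ]· c
[]·-nonNeg true  c≥0 = c≥0
[]·-nonNeg false c≥0 = ≤-refl

[≟]·-yes : ∀ {n} {a g : Fin n} (c : ℚ) → a ≡ g → [ ⌊ a ≟ g ⌋ ]· c ≡ c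
[≟]·-yes {a = a} {g} c a≡g with a ≟ g
... | yes _  = refl
... | no a≢g = contradiction a≡g a≢g

[suc≟suc]· : ∀ {n} (a g : Fin n) (c : ℚ) →
             [ ⌊ suc a ≟ suc g ⌋ ]· c ≡ [ ⌊ a ≟ g ⌋ ]· c
[suc≟suc]· a g c = cong ([_]· c) (⌊⌋-map′ (cong suc) suc-injective (a ≟ g))

sumℚ-map-cong : (L : List A) {f g : A → ℚ} → (∀ x → f x ≡ g x) →
                sumℚ (map f L) ≡ sumℚ (map g L)
sumℚ-map-cong L f≗g = cong sumℚ (map-cong f≗g L)

sumℚ-map-0 : (L : List A) → sumℚ (map (λ _ → 0ℚ) L) ≡ 0ℚ
sumℚ-map-0 []      = refl
sumℚ-map-0 (_ ∷ L) = trans (+-identityˡ _) (sumℚ-map-0 L)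

sumℚ-map-+ : (L : List A) (f g : A → ℚ) →
             sumℚ (map (λ x → f x + g x) L) ≡ sumℚ (map f L) + sumℚ (map g L)
sumℚ-map-+ []      f g = sym (+-identityʳ 0ℚ)
sumℚ-map-+ (x ∷ L) f g =
  trans (cong (f x + g x +_) (sumℚ-map-+ L f g))
        (interchange (f x) (g x) (sumℚ (map f L)) (sumℚ (map g L)))

sumℚ-map-comm : (I : List B) (L : List A) (h : B → A → ℚ) →
                sumℚ (map (λ x → sumℚ (map (λ i → h i x) I)) L)
                  ≡ sumℚ (map (λ i → sumℚ (map (h i) L)) I)
sumℚ-map-comm []      L h = sumℚ-map-0 L
sumℚ-map-comm (i ∷ I) L h =
  trans (sumℚ-map-+ L (h i) (λ x → sumℚ (map (λ i → h i x) I)))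
        (cong (sumℚ (map (h i) L) +_) (sumℚ-map-comm I L h))

sumℚ-map-mono-≤ : (L : List A) {f g : A → ℚ} → (∀ x → f x ℚ.≤ g x) →
                  sumℚ (map f L) ℚ.≤ sumℚ (map g L)
sumℚ-map-mono-≤ []      f≤g = ≤-refl
sumℚ-map-mono-≤ (x ∷ L) f≤g = +-mono-≤ (f≤g x) (sumℚ-map-mono-≤ L f≤g)

sumℚ-map-nonNeg : (L : List A) {f : A → ℚ} → (∀ x → 0ℚ ℚ.≤ f x) →
                  0ℚ ℚ.≤ sumℚ (map f L)
sumℚ-map-nonNeg L f≥0 =
  ≤-trans (≤-reflexive (sym (sumℚ-map-0 L))) (sumℚ-map-mono-≤ L f≥0)

∈⇒≤-sumℚ-map : (L : List A) {f : A → ℚ} → (∀ x → 0ℚ ℚ.≤ f x) →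
               ∀ {a} → a ∈ L → f a ℚ.≤ sumℚ (map f L)
∈⇒≤-sumℚ-map (x ∷ L) {f} f≥0 (here refl) =
  ≤-trans (≤-reflexive (sym (+-identityʳ (f x))))
          (+-monoʳ-≤ (f x) (sumℚ-map-nonNeg L f≥0))
∈⇒≤-sumℚ-map (x ∷ L) {f} f≥0 (there a∈L) =
  ≤-trans (∈⇒≤-sumℚ-map L f≥0 a∈L)
          (≤-trans (≤-reflexive (sym (+-identityˡ _))) (+-mono-≤ (f≥0 x) ≤-refl))

map-allFin-suc : ∀ {n} (h : Fin (ℕ.suc n) → A) →
                 map h (allFin (ℕ.suc n)) ≡ h zero ∷ map (h ∘ suc) (allFin n)
map-allFin-suc h =
  cong (h zero ∷_) (trans (map-tabulate suc h) (sym (map-tabulate id (h ∘ suc))))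

sumℚ-[≟]· : ∀ {n} (a : Fin n) (c : ℚ) →
            sumℚ (map (λ g → [ ⌊ a ≟ g ⌋ ]· c) (allFin n)) ≡ c
sumℚ-[≟]· {ℕ.suc n} zero c = begin
  sumℚ (map (λ g → [ ⌊ zero ≟ g ⌋ ]· c) (allFin (ℕ.suc n)))
    ≡⟨ cong sumℚ (map-allFin-suc {n = n} (λ g → [ ⌊ zero ≟ g ⌋ ]· c)) ⟩
  c + sumℚ (map (λ _ → 0ℚ) (allFin n))
    ≡⟨ cong (c +_) (sumℚ-map-0 (allFin n)) ⟩
  c + 0ℚ
    ≡⟨ +-identityʳ c ⟩
  c ∎
  where open ≡-Reasoning
sumℚ-[≟]· {ℕ.suc n} (suc a) c = begin
  sumℚ (map (λ g → [ ⌊ suc a ≟ g ⌋ ]· c) (allFin (ℕ.suc n)))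
    ≡⟨ cong sumℚ (map-allFin-suc {n = n} (λ g → [ ⌊ suc a ≟ g ⌋ ]· c)) ⟩
  0ℚ + sumℚ (map (λ g → [ ⌊ suc a ≟ suc g ⌋ ]· c) (allFin n))
    ≡⟨ +-identityˡ _ ⟩
  sumℚ (map (λ g → [ ⌊ suc a ≟ suc g ⌋ ]· c) (allFin n))
    ≡⟨ sumℚ-map-cong (allFin n) (λ g → [suc≟suc]· a g c) ⟩
  sumℚ (map (λ g → [ ⌊ a ≟ g ⌋ ]· c) (allFin n))
    ≡⟨ sumℚ-[≟]· a c ⟩
  c ∎
  where open ≡-Reasoning

inv-pos : ∀ n .{{_ : ℕ.NonZero n}} → 0ℚ ℚ.< inv n
inv-pos (ℕ.suc n) = positive⁻¹ _ {{normalize-pos 1 (ℕ.suc n)}}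

weightedOccurrences : (k : ℕ) → (Point k → ℚ) → Fin k → Point k → ℚ
weightedOccurrences k μ g x = sumℚ (map (λ i → [ ⌊ lookup x i ≟ g ⌋ ]· μ x) (allFin k))

module _ {k : ℕ} (μ : Point k → ℚ) where

  sumℚ-weightedOccurrences : ∀ g →
    sumℚ (map (weightedOccurrences k μ g) (allVecs k k))
      ≡ sumℚ (map (λ i → prob1 k μ i g) (allFin k))
  sumℚ-weightedOccurrences g =
    sumℚ-map-comm (allFin k) (allVecs k k) (λ i x → [ ⌊ lookup x i ≟ g ⌋ ]· μ x)

  sumℚ-prob1 : ∀ i → sumℚ (map (prob1 k μ i) (allFin k)) ≡ total k μ
  sumℚ-prob1 i = begin
    sumℚ (map (prob1 k μ i) (allFin k))
      ≡⟨ sumℚ-map-comm (allFin k) (allVecs k k) (λ g x → [ ⌊ lookup x i ≟ g ⌋ ]· μ x) ⟨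
    sumℚ (map (λ x → sumℚ (map (λ g → [ ⌊ lookup x i ≟ g ⌋ ]· μ x) (allFin k))) (allVecs k k))
      ≡⟨ sumℚ-map-cong (allVecs k k) (λ x → sumℚ-[≟]· (lookup x i) (μ x)) ⟩
    total k μ ∎
    where open ≡-Reasoning

  -- All one-point marginals equal 1/k, so Σᵢ Pr[xᵢ = g] = Σₕ Pr[x_g = h] = 1,
  -- which avoids computing k · (1/k) in ℚ.
  sumℚ-weightedOccurrences≡1 : (∀ i g → prob1 k μ i g ≡ inv k) → total k μ ≡ 1ℚ →
    ∀ g → sumℚ (map (weightedOccurrences k μ g) (allVecs k k)) ≡ 1ℚ
  sumℚ-weightedOccurrences≡1 balanced total≡1 g = begin
    sumℚ (map (weightedOccurrences k μ g) (allVecs k k))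
      ≡⟨ sumℚ-weightedOccurrences g ⟩
    sumℚ (map (λ i → prob1 k μ i g) (allFin k))
      ≡⟨ sumℚ-map-cong (allFin k) (λ i → trans (balanced i g) (sym (balanced g i))) ⟩
    sumℚ (map (prob1 k μ g) (allFin k))
      ≡⟨ sumℚ-prob1 g ⟩
    total k μ
      ≡⟨ total≡1 ⟩
    1ℚ ∎
    where open ≡-Reasoning

module _ {k : ℕ} (μ : Point k → ℚ) {g : Fin k} {x : Point k} (μx≥0 : 0ℚ ℚ.≤ μ x) where

  [lookup≟]·-nonNeg : ∀ i → 0ℚ ℚ.≤ [ ⌊ lookup x i ≟ g ⌋ ]· μ x
  [lookup≟]·-nonNeg i = []·-nonNeg ⌊ lookup x i ≟ g ⌋ μx≥0

  weightedOccurrences-nonNeg : 0ℚ ℚ.≤ weightedOccurrences k μ g x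
  weightedOccurrences-nonNeg = sumℚ-map-nonNeg (allFin k) [lookup≟]·-nonNeg

  occurrence⇒≤weightedOccurrences : ∀ {i} → lookup x i ≡ g →
                                    μ x ℚ.≤ weightedOccurrences k μ g x
  occurrence⇒≤weightedOccurrences {i} xᵢ≡g =
    ≤-trans (≤-reflexive (sym ([≟]·-yes (μ x) xᵢ≡g)))
            (∈⇒≤-sumℚ-map (allFin k) [lookup≟]·-nonNeg (∈-allFin i))

  supported⇒≤weightedOccurrences : (μ x ≢ 0ℚ → ∃[ i ] lookup x i ≡ g) →
                                   μ x ℚ.≤ weightedOccurrences k μ g x
  supported⇒≤weightedOccurrences occurs with μ x ℚ.≟ 0ℚ
  ... | yes μx≡0 = ≤-trans (≤-reflexive μx≡0) weightedOccurrences-nonNeg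
  ... | no μx≢0  = let (i , xᵢ≡g) = occurs μx≢0 in occurrence⇒≤weightedOccurrences xᵢ≡g

module _ {m : ℕ} (μ : Point (2 ℕ.+ m) → ℚ) {g : Fin (2 ℕ.+ m)} {x : Point (2 ℕ.+ m)}
         (μx≥0 : 0ℚ ℚ.≤ μ x) where

  two-occurrences⇒≤weightedOccurrences : lookup x zero ≡ g → lookup x (suc zero) ≡ g →
                                         μ x + μ x ℚ.≤ weightedOccurrences (2 ℕ.+ m) μ g x
  two-occurrences⇒≤weightedOccurrences x₀≡g x₁≡g = begin
    μ x + μ x
      ≡⟨ cong (μ x +_) (+-identityʳ (μ x)) ⟨
    μ x + (μ x + 0ℚ)
      ≤⟨ +-monoʳ-≤ (μ x) (+-monoʳ-≤ (μ x) rest-nonNeg) ⟩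
    μ x + (μ x + rest)
      ≡⟨ cong₂ (λ a b → a + (b + rest)) ([≟]·-yes (μ x) x₀≡g) ([≟]·-yes (μ x) x₁≡g) ⟨
    weightedOccurrences (2 ℕ.+ m) μ g x ∎
    where
    open ≤-Reasoning
    -- allFin (2 + m) unfolds definitionally to 0 ∷ 1 ∷ tabulate (suc ∘ suc).
    rest : ℚ
    rest = sumℚ (map (λ i → [ ⌊ lookup x i ≟ g ⌋ ]· μ x) (tabulate (suc ∘ suc)))
    rest-nonNeg : 0ℚ ℚ.≤ rest
    rest-nonNeg = sumℚ-map-nonNeg (tabulate (suc ∘ suc)) ([lookup≟]·-nonNeg μ μx≥0)

  supported⇒prob2-summand≤weightedOccurrences :
    (μ x ≢ 0ℚ → ∃[ i ] lookup x i ≡ g) →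
    μ x + [ ⌊ lookup x zero ≟ g ⌋ ∧ ⌊ lookup x (suc zero) ≟ g ⌋ ]· μ x
      ℚ.≤ weightedOccurrences (2 ℕ.+ m) μ g x
  supported⇒prob2-summand≤weightedOccurrences occurs =
    by-cases (lookup x zero ≟ g) (lookup x (suc zero) ≟ g)
    where
    one-occurrence : μ x + 0ℚ ℚ.≤ weightedOccurrences (2 ℕ.+ m) μ g x
    one-occurrence =
      ≤-trans (≤-reflexive (+-identityʳ (μ x))) (supported⇒≤weightedOccurrences μ μx≥0 occurs)

    by-cases : (x₀≟g : Dec (lookup x zero ≡ g)) (x₁≟g : Dec (lookup x (suc zero) ≡ g)) →
               μ x + [ ⌊ x₀≟g ⌋ ∧ ⌊ x₁≟g ⌋ ]· μ x ℚ.≤ weightedOccurrences (2 ℕ.+ m) μ g x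
    by-cases (yes x₀≡g) (yes x₁≡g) = two-occurrences⇒≤weightedOccurrences x₀≡g x₁≡g
    by-cases (yes _)    (no _)     = one-occurrence
    by-cases (no _)     _          = one-occurrence

total+prob2≤sumℚ-weightedOccurrences :
  ∀ {m} (μ : Point (2 ℕ.+ m) → ℚ) {g} → (∀ x → 0ℚ ℚ.≤ μ x) →
  (∀ x → μ x ≢ 0ℚ → ∃[ i ] lookup x i ≡ g) →
  total (2 ℕ.+ m) μ + prob2 (2 ℕ.+ m) μ zero (suc zero) g g
    ℚ.≤ sumℚ (map (weightedOccurrences (2 ℕ.+ m) μ g) (allVecs (2 ℕ.+ m) (2 ℕ.+ m)))
total+prob2≤sumℚ-weightedOccurrences {m} μ {g} μ≥0 occurs =
  ≤-trans (≤-reflexive (sym (sumℚ-map-+ points μ first-two≡g)))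
          (sumℚ-map-mono-≤ points (λ x →
            supported⇒prob2-summand≤weightedOccurrences μ (μ≥0 x) (occurs x)))
  where
  points : List (Point (2 ℕ.+ m))
  points = allVecs (2 ℕ.+ m) (2 ℕ.+ m)
  first-two≡g : Point (2 ℕ.+ m) → ℚ
  first-two≡g x = [ ⌊ lookup x zero ≟ g ⌋ ∧ ⌊ lookup x (suc zero) ≟ g ⌋ ]· μ x

lemma10 : (k : ℕ) → 2 ≤ k →
    ¬ (∃[ μ ] (IsBalancedPairwiseIndependent k μ
               × (∀ x → InSupport k μ x → ∃[ i ] (toℕ (lookup x i) ≡ 0))))
lemma10 (ℕ.suc (ℕ.suc m)) (s≤s (s≤s z≤n))
        (μ , ((μ≥0 , total≡1) , balanced , pairwise) , zero-in-support) =
  <-irrefl refl (begin-strict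
    1ℚ
      ≡⟨ +-identityʳ 1ℚ ⟨
    1ℚ + 0ℚ
      <⟨ +-monoʳ-< 1ℚ (inv-pos (k ℕ.* k)) ⟩
    1ℚ + inv (k ℕ.* k)
      ≡⟨ cong₂ _+_ total≡1 (pairwise zero (suc zero) zero zero (λ ())) ⟨
    total k μ + prob2 k μ zero (suc zero) zero zero
      ≤⟨ total+prob2≤sumℚ-weightedOccurrences μ μ≥0 occurs ⟩
    sumℚ (map (weightedOccurrences k μ zero) (allVecs k k))
      ≡⟨ sumℚ-weightedOccurrences≡1 μ balanced total≡1 zero ⟩
    1ℚ ∎)
  where
  open ≤-Reasoning
  k : ℕ
  k = 2 ℕ.+ m
  occurs : ∀ x → μ x ≢ 0ℚ → ∃[ i ] lookup x i ≡ zero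
  occurs x μx≢0 = let (i , xᵢ≡0) = zero-in-support x μx≢0 in i , toℕ-injective xᵢ≡0
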